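{- For any integers $k,m\ge0$ there is a simplicial map $\mathbb{S}^k_{k+2}\star\mathbb{S}^m_{m+2}\to\mathbb{S}^{k+m+1}_{k+m+3}$ of degree $1$.
   Context: $\mathbb{S}^n_{n+2}$ denotes the standard triangulation of the $n$-sphere with $n+2$ vertices (the boundary of the $(n+1)$-simplex); for $n=0$ it is two points. The join $K\star L$ of simplicial complexes has vertex set $V(K)\sqcup V(L)$ and faces the faces of $K$, the faces of $L$, and unions of a face of $K$ with a face of $L$; $|\mathbb{S}^k_{k+2}\star\mathbb{S}^m_{m+2}|\cong\mathbb{S}^{k+m+1}$. Spheres are given fixed orientations, and the degree is the integer by which the map acts on top integral homology. -}

module Defs where

open import Data.Nat as ℕ using (ℕ; zero; suc; _+_)
open import Data.Integer as ℤ using (ℤ; 0ℤ; 1ℤ; -1ℤ; _*_)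
open import Data.Fin as Fin using (Fin; toℕ; punchIn)
open import Data.Fin.Subset using (Subset; ⊤; _∈_)
open import Data.Bool using (Bool; true; false; if_then_else_; _∧_; not; _∨_)
open import Data.List using (List; []; _∷_; map; _++_; tabulate)
open import Data.Sum using (_⊎_; inj₁; inj₂)
open import Data.Product using (∃; _×_)
open import Relation.Binary.PropositionalEquality using (_≡_; _≢_)

-- The spheres  S^n_{n+2} = ∂Δ^{n+1}  on vertex set Fin (suc (suc n)):
-- faces are the proper subsets of the vertex set.

SVert : ℕ → Set
SVert n = Fin (suc (suc n))

IsFaceS : (n : ℕ) → Subset (suc (suc n)) → Set
IsFaceS n σ = σ ≢ ⊤

-- The join  S^k_{k+2} ⋆ S^m_{m+2}:  vertex set  V(S^k) ⊎ V(S^m);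
-- faces are the unions A ⊔ B of a face A of S^k and a face B of S^m
-- (this includes the faces of each factor, taking the other part empty).

JVert : ℕ → ℕ → Set
JVert k m = SVert k ⊎ SVert m

-- A vertex map  f : V(S^k ⋆ S^m) → V(S^{k+m+1}_{k+m+3})  is simplicial
-- iff the image of every face of the join is a face of the target,
-- i.e. misses some vertex of the target.
IsSimplicial : (k m : ℕ) → (JVert k m → SVert (k + m + 1)) → Set
IsSimplicial k m f =
  (A : Subset (suc (suc k))) (B : Subset (suc (suc m))) → IsFaceS k A → IsFaceS m B →
  ∃ λ (l : SVert (k + m + 1)) →
    ((i : Fin (suc (suc k))) → i ∈ A → f (inj₁ i) ≢ l) ×
    ((j : Fin (suc (suc m))) → j ∈ B → f (inj₂ j) ≢ l)

sgn : ℕ → ℤ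
sgn zero = 1ℤ
sgn (suc n) = ℤ.- sgn n

sumFin : {n : ℕ} → (Fin n → ℤ) → ℤ
sumFin {zero} g = 0ℤ
sumFin {suc n} g = g Fin.zero ℤ.+ sumFin (λ i → g (Fin.suc i))

elemᵇ : {N : ℕ} → Fin N → List (Fin N) → Bool
elemᵇ x [] = false
elemᵇ x (y ∷ ys) = (toℕ x ℕ.≡ᵇ toℕ y) ∨ elemᵇ x ys

distinctᵇ : {N : ℕ} → List (Fin N) → Bool
distinctᵇ [] = true
distinctᵇ (x ∷ xs) = not (elemᵇ x xs) ∧ distinctᵇ xs

countSmaller : {N : ℕ} → Fin N → List (Fin N) → ℕ
countSmaller x [] = 0
countSmaller x (y ∷ ys) = (if toℕ y ℕ.<ᵇ toℕ x then 1 else 0) + countSmaller x ys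

inversions : {N : ℕ} → List (Fin N) → ℕ
inversions [] = 0
inversions (x ∷ xs) = countSmaller x xs + inversions xs

-- The top-dimensional simplices of S^n_{n+2} are indexed by the omitted
-- vertex l; the top chain group is identified with  Fin (suc (suc n)) → ℤ,
-- the coefficient at l being that of the facet omitting l, oriented by
-- the increasing order of its vertices.
-- An ordered (n+1)-tuple t of vertices of S^n_{n+2} (oriented simplex)
-- is, as a chain: 0 if it has a repeated vertex, and otherwise
-- sign(sorting permutation) times the increasingly oriented facet
-- spanned by t.
orientedFacet : (n : ℕ) → List (SVert n) → SVert n → ℤ
orientedFacet n t l =
  if distinctᵇ t ∧ not (elemᵇ l t) then sgn (inversions t) else 0ℤ

facet : (n : ℕ) → SVert n → List (SVert n)
facet n i = tabulate (punchIn i)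

-- Fundamental cycle of S^n_{n+2}:   Σ_i (-1)^i [0,…,î,…,n+1]
fundS : (n : ℕ) → SVert n → ℤ
fundS n l = sgn (toℕ l)

-- Fundamental cycle of the join S^k ⋆ S^m: the join of the fundamental
-- cycles,  Σ_{i,j} (-1)^{i+j} [facet_i(S^k) , facet_j(S^m)]
-- (ordered simplex: vertices of the first factor, then of the second).
joinFacet : (k m : ℕ) → SVert k → SVert m → List (JVert k m)
joinFacet k m i j = map inj₁ (facet k i) ++ map inj₂ (facet m j)

-- Image under the induced chain map f_# of the join fundamental cycle,
-- as a top chain of the target S^{k+m+1}_{k+m+3}.
pushFund : (k m : ℕ) → (JVert k m → SVert (k + m + 1)) →
           SVert (k + m + 1) → ℤ
pushFund k m f l =
  sumFin λ i → sumFin λ j →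
    sgn (toℕ i + toℕ j) * orientedFacet (k + m + 1) (map f (joinFacet k m i j)) l

-- An orientation of a sphere = choice of sign of the fundamental cycle
-- (a generator of top integral homology).
data Orientation : Set where
  pos neg : Orientation

oℤ : Orientation → ℤ
oℤ pos = 1ℤ
oℤ neg = -1ℤ

-- Degree: since there are no simplices above the top dimension,
-- H_top = Z_top, and f_* on H_top is f_# on top cycles.
-- f has degree d (w.r.t. orientations o₁ of the source, o₂ of the target)
-- iff  f_# (o₁ · [source]) = d · (o₂ · [target]).
HasDegree : (k m : ℕ) → Orientation → Orientation →
            (JVert k m → SVert (k + m + 1)) → ℤ → Set
HasDegree k m o₁ o₂ f d =
  (l : SVert (k + m + 1)) →
  oℤ o₁ * pushFund k m f l ≡ d * (oℤ o₂ * fundS (k + m + 1) l)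

-- The map sends the vertices 0,…,k+1 of the first sphere to 0,…,k+1 and
-- the vertices 0,…,m+1 of the second to k+1,…,k+m+2, gluing the last
-- vertex of the first sphere to the first vertex of the second. A face
-- A ⊔ B of the join misses some vertex i of the first sphere: if i ≤ k its
-- image is missed by the image of the face, and if i = k+1 so is the
-- image of a vertex missed by B. A facet (i , j) of the join maps to a
-- degenerate simplex unless i = k+1 or j = 0, and the nondegenerate ones
-- are, with their signs, exactly the facets of the target, each once;
-- so the map has degree 1. Degree −1 is obtained by composing with the
-- transposition of the target vertices 0 and 1.
module Submission where

open import Defs
open import Data.Nat using (ℕ; _+_)
open import Data.Integer using (1ℤ)
open import Data.Product using (∃; _×_)

open import Data.Nat using (zero; suc; _≤_; _<_; _∸_; z≤n; s≤s; _≡ᵇ_; _<ᵇ_; z<s; _≤?_)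
open import Data.Nat.Properties
open import Data.Integer as ℤ using (ℤ; 0ℤ; -1ℤ; _*_)
import Data.Integer.Properties as ℤ
open import Data.Fin as Fin using (Fin; toℕ; punchIn; fromℕ<)
import Data.Fin.Properties as Fin
open import Data.Fin.Subset using (Subset; ⊤; _∈_; _∉_)
open import Data.Fin.Subset.Properties using (_∈?_; ⊆-antisym; ⊆⊤)
open import Data.Bool using (Bool; true; false; if_then_else_; _∧_; not; _∨_; T)
open import Data.Bool.Properties using (∨-assoc; ∨-zeroʳ; ∧-zeroʳ; ∧-identityʳ; not-involutive)
open import Data.List using (List; []; _∷_; map; _++_; tabulate)
open import Data.List.Properties
  using (map-++; ++-assoc; ++-identityʳ; map-id; map-tabulate; tabulate-cong; map-∘; map-cong)
open import Data.Sum using (inj₁; inj₂)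
open import Data.Product using (_,_)
open import Data.Unit using (tt) renaming (⊤ to Unit)
open import Data.Empty using (⊥-elim)
open import Relation.Binary.PropositionalEquality
open import Function using (id; _∘_; _$_)
open import Relation.Binary.Definitions using (tri<; tri≈; tri>)
open import Relation.Nullary using (yes; no)

-- Defs inspects list entries only through toℕ, so all chain computations
-- are carried out on lists of natural numbers.

elemℕ : ℕ → List ℕ → Bool
elemℕ x [] = false
elemℕ x (y ∷ ys) = (x ≡ᵇ y) ∨ elemℕ x ys

distinctℕ : List ℕ → Bool
distinctℕ [] = true
distinctℕ (x ∷ xs) = not (elemℕ x xs) ∧ distinctℕ xs

countSmallerℕ : ℕ → List ℕ → ℕ
countSmallerℕ x [] = 0
countSmallerℕ x (y ∷ ys) = (if y <ᵇ x then 1 else 0) + countSmallerℕ x ys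

inversionsℕ : List ℕ → ℕ
inversionsℕ [] = 0
inversionsℕ (x ∷ xs) = countSmallerℕ x xs + inversionsℕ xs

orientedFacetℕ : List ℕ → ℕ → ℤ
orientedFacetℕ t l = if distinctℕ t ∧ not (elemℕ l t) then sgn (inversionsℕ t) else 0ℤ

elemᵇ-toℕ : ∀ {n} (x : Fin n) ys → elemᵇ x ys ≡ elemℕ (toℕ x) (map toℕ ys)
elemᵇ-toℕ x [] = refl
elemᵇ-toℕ x (y ∷ ys) = cong ((toℕ x ≡ᵇ toℕ y) ∨_) (elemᵇ-toℕ x ys)

distinctᵇ-toℕ : ∀ {n} (ys : List (Fin n)) → distinctᵇ ys ≡ distinctℕ (map toℕ ys)
distinctᵇ-toℕ [] = refl
distinctᵇ-toℕ (y ∷ ys) = cong₂ (λ a b → not a ∧ b) (elemᵇ-toℕ y ys) (distinctᵇ-toℕ ys)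

countSmaller-toℕ : ∀ {n} (x : Fin n) ys → countSmaller x ys ≡ countSmallerℕ (toℕ x) (map toℕ ys)
countSmaller-toℕ x [] = refl
countSmaller-toℕ x (y ∷ ys) = cong ((if toℕ y <ᵇ toℕ x then 1 else 0) +_) (countSmaller-toℕ x ys)

inversions-toℕ : ∀ {n} (ys : List (Fin n)) → inversions ys ≡ inversionsℕ (map toℕ ys)
inversions-toℕ [] = refl
inversions-toℕ (y ∷ ys) = cong₂ _+_ (countSmaller-toℕ y ys) (inversions-toℕ ys)

orientedFacet-toℕ : ∀ n t l → orientedFacet n t l ≡ orientedFacetℕ (map toℕ t) (toℕ l)
orientedFacet-toℕ n t l rewrite distinctᵇ-toℕ t | elemᵇ-toℕ l t | inversions-toℕ t = refl

≡ᵇ-refl : ∀ n → (n ≡ᵇ n) ≡ true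
≡ᵇ-refl zero = refl
≡ᵇ-refl (suc n) = ≡ᵇ-refl n

≡ᵇ-true⇒≡ : ∀ {m n} → (m ≡ᵇ n) ≡ true → m ≡ n
≡ᵇ-true⇒≡ {m} {n} eq = ≡ᵇ⇒≡ m n (subst T (sym eq) tt)

≢⇒≡ᵇ-false : ∀ {m n} → m ≢ n → (m ≡ᵇ n) ≡ false
≢⇒≡ᵇ-false {m} {n} m≢n with m ≡ᵇ n in eq
... | false = refl
... | true = ⊥-elim (m≢n (≡ᵇ-true⇒≡ eq))

+-cancelˡ-≡ᵇ : ∀ c x y → (c + x ≡ᵇ c + y) ≡ (x ≡ᵇ y)
+-cancelˡ-≡ᵇ zero x y = refl
+-cancelˡ-≡ᵇ (suc c) x y = +-cancelˡ-≡ᵇ c x y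

≤⇒<ᵇ-false : ∀ {x y} → x ≤ y → (y <ᵇ x) ≡ false
≤⇒<ᵇ-false {x} {y} x≤y with y <ᵇ x in eq
... | false = refl
... | true = ⊥-elim (<⇒≱ (<ᵇ⇒< y x (subst T (sym eq) tt)) x≤y)

IncreasingFrom : ℕ → List ℕ → Set
IncreasingFrom b [] = Unit
IncreasingFrom b (x ∷ xs) = b ≤ x × IncreasingFrom (suc x) xs

IncreasingFrom-weaken : ∀ {c b} xs → c ≤ b → IncreasingFrom b xs → IncreasingFrom c xs
IncreasingFrom-weaken [] _ _ = tt
IncreasingFrom-weaken (x ∷ xs) c≤b (b≤x , inc) = ≤-trans c≤b b≤x , inc

elemℕ-below : ∀ {c b} xs → c < b → IncreasingFrom b xs → elemℕ c xs ≡ false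
elemℕ-below [] _ _ = refl
elemℕ-below (x ∷ xs) c<b (b≤x , inc) =
  cong₂ _∨_ (≢⇒≡ᵇ-false (<⇒≢ c<x)) (elemℕ-below xs (m≤n⇒m≤1+n c<x) inc)
  where c<x = <-≤-trans c<b b≤x

countSmallerℕ-below : ∀ {c b} xs → c ≤ b → IncreasingFrom b xs → countSmallerℕ c xs ≡ 0
countSmallerℕ-below [] _ _ = refl
countSmallerℕ-below (x ∷ xs) c≤b (b≤x , inc)
  rewrite ≤⇒<ᵇ-false (≤-trans c≤b b≤x)
  = countSmallerℕ-below xs (m≤n⇒m≤1+n (≤-trans c≤b b≤x)) inc

IncreasingFrom⇒distinct : ∀ {b} xs → IncreasingFrom b xs → distinctℕ xs ≡ true
IncreasingFrom⇒distinct [] _ = refl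
IncreasingFrom⇒distinct (x ∷ xs) (_ , inc)
  rewrite elemℕ-below xs (n<1+n x) inc | IncreasingFrom⇒distinct xs inc = refl

IncreasingFrom⇒no-inversions : ∀ {b} xs → IncreasingFrom b xs → inversionsℕ xs ≡ 0
IncreasingFrom⇒no-inversions [] _ = refl
IncreasingFrom⇒no-inversions (x ∷ xs) (_ , inc)
  rewrite countSmallerℕ-below xs (n≤1+n x) inc | IncreasingFrom⇒no-inversions xs inc = refl

elemℕ-++ : ∀ x xs ys → elemℕ x (xs ++ ys) ≡ elemℕ x xs ∨ elemℕ x ys
elemℕ-++ x [] ys = refl
elemℕ-++ x (y ∷ xs) ys rewrite elemℕ-++ x xs ys = sym (∨-assoc (x ≡ᵇ y) (elemℕ x xs) (elemℕ x ys))

elemℕ-++-self : ∀ y xs ys → elemℕ y (xs ++ y ∷ ys) ≡ true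
elemℕ-++-self y xs ys rewrite elemℕ-++ y xs (y ∷ ys) | ≡ᵇ-refl y = ∨-zeroʳ (elemℕ y xs)

distinctℕ-repeat : ∀ xs y ys → elemℕ y xs ≡ true → distinctℕ (xs ++ y ∷ ys) ≡ false
distinctℕ-repeat [] y ys ()
distinctℕ-repeat (x ∷ xs) y ys y∈x∷xs with elemℕ y xs in y∈xs
... | true rewrite distinctℕ-repeat xs y ys y∈xs = ∧-zeroʳ _
... | false with y ≡ᵇ x in y≡ᵇx
...   | true with refl ← ≡ᵇ-true⇒≡ {y} {x} y≡ᵇx rewrite elemℕ-++-self y xs ys = refl
distinctℕ-repeat (x ∷ xs) y ys () | false | false

segment : ℕ → ℕ → List ℕ
segment a zero = []
segment a (suc n) = a ∷ segment (suc a) n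

omitting : ℕ → ℕ → List ℕ
omitting p q = segment 0 p ++ segment (suc p) q

segment-increasing : ∀ {b} a n → b ≤ a → IncreasingFrom b (segment a n)
segment-increasing a zero _ = tt
segment-increasing a (suc n) b≤a = b≤a , segment-increasing (suc a) n ≤-refl

segment-++-increasing : ∀ {b} a n ys → b ≤ a → IncreasingFrom (a + n) ys →
                        IncreasingFrom b (segment a n ++ ys)
segment-++-increasing a zero ys b≤a inc =
  IncreasingFrom-weaken ys b≤a (subst (λ c → IncreasingFrom c ys) (+-identityʳ a) inc)
segment-++-increasing a (suc n) ys b≤a inc =
  b≤a , segment-++-increasing (suc a) n ys ≤-refl (subst (λ c → IncreasingFrom c ys) (+-suc a n) inc)

omitting-increasing : ∀ p q → IncreasingFrom 0 (omitting p q)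
omitting-increasing p q =
  segment-++-increasing 0 p (segment (suc p) q) z≤n (segment-increasing (suc p) q (n≤1+n p))

elemℕ-segment-inside : ∀ l a n → a ≤ l → l < a + n → elemℕ l (segment a n) ≡ true
elemℕ-segment-inside l a zero a≤l l<a rewrite +-identityʳ a = ⊥-elim (<⇒≱ l<a a≤l)
elemℕ-segment-inside l a (suc n) a≤l l<a+n with m≤n⇒m<n∨m≡n a≤l
... | inj₂ refl rewrite ≡ᵇ-refl a = refl
... | inj₁ a<l rewrite elemℕ-segment-inside l (suc a) n a<l (subst (l <_) (+-suc a n) l<a+n) =
  ∨-zeroʳ (l ≡ᵇ a)

elemℕ-segment-above : ∀ l a n → a + n ≤ l → elemℕ l (segment a n) ≡ false
elemℕ-segment-above l a zero _ = refl
elemℕ-segment-above l a (suc n) a+n≤l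
  rewrite ≢⇒≡ᵇ-false (≢-sym (<⇒≢ (<-≤-trans (m<m+n a z<s) a+n≤l)))
  = elemℕ-segment-above l (suc a) n (subst (_≤ l) (+-suc a n) a+n≤l)

elemℕ-omitting : ∀ p q l → l ≤ p + q → elemℕ l (omitting p q) ≡ not (l ≡ᵇ p)
elemℕ-omitting p q l l≤ rewrite elemℕ-++ l (segment 0 p) (segment (suc p) q) with <-cmp l p
... | tri< l<p _ _
  rewrite elemℕ-segment-inside l 0 p z≤n l<p | ≢⇒≡ᵇ-false (<⇒≢ l<p) = refl
... | tri≈ _ refl _
  rewrite elemℕ-segment-above l 0 l ≤-refl
        | elemℕ-below (segment (suc l) q) (n<1+n l) (segment-increasing (suc l) q ≤-refl)
        | ≡ᵇ-refl l = refl
... | tri> _ _ p<l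
  rewrite elemℕ-segment-inside l (suc p) q p<l (s≤s l≤) | ≢⇒≡ᵇ-false (≢-sym (<⇒≢ p<l)) =
  ∨-zeroʳ _

orientedFacetℕ-omitting : ∀ p q l → l ≤ p + q →
  orientedFacetℕ (omitting p q) l ≡ (if l ≡ᵇ p then 1ℤ else 0ℤ)
orientedFacetℕ-omitting p q l l≤
  rewrite IncreasingFrom⇒distinct (omitting p q) (omitting-increasing p q)
        | IncreasingFrom⇒no-inversions (omitting p q) (omitting-increasing p q)
        | elemℕ-omitting p q l l≤
        | not-involutive (l ≡ᵇ p) = refl

swap01 : ℕ → ℕ
swap01 zero = 1
swap01 (suc zero) = 0
swap01 (suc (suc n)) = suc (suc n)

swap01-fixes : ∀ {x} → 2 ≤ x → swap01 x ≡ x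
swap01-fixes {suc (suc x)} _ = refl
swap01-fixes {suc zero} (s≤s ())

map-swap01-increasing : ∀ {b} xs → 2 ≤ b → IncreasingFrom b xs → map swap01 xs ≡ xs
map-swap01-increasing [] _ _ = refl
map-swap01-increasing (x ∷ xs) 2≤b (b≤x , inc) =
  cong₂ _∷_ (swap01-fixes (≤-trans 2≤b b≤x))
            (map-swap01-increasing xs (≤-trans 2≤b (m≤n⇒m≤1+n b≤x)) inc)

sgn-indicator : ∀ p l x → sgn p * (if l ≡ᵇ p then x else 0ℤ) ≡ (if l ≡ᵇ p then x * sgn l else 0ℤ)
sgn-indicator p l x with l ≡ᵇ p in l≡ᵇp
... | true with refl ← ≡ᵇ-true⇒≡ {l} {p} l≡ᵇp = ℤ.*-comm (sgn l) x
... | false = ℤ.*-zeroʳ (sgn p)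

omitting-sign : ∀ p q l → l ≤ p + q →
  sgn p * orientedFacetℕ (omitting p q) l ≡ (if l ≡ᵇ p then 1ℤ * sgn l else 0ℤ)
omitting-sign p q l l≤ rewrite orientedFacetℕ-omitting p q l l≤ = sgn-indicator p l 1ℤ

omitting-tail : ℕ → ℕ → List ℕ
omitting-tail p q = segment 2 p ++ segment (suc (suc (suc p))) q

omitting-tail-increasing : ∀ p q → IncreasingFrom 2 (omitting-tail p q)
omitting-tail-increasing p q =
  segment-++-increasing 2 p _ ≤-refl (segment-increasing (suc (suc (suc p))) q (n≤1+n _))

orientedFacetℕ-10 : ∀ rest l → IncreasingFrom 2 rest →
  orientedFacetℕ (1 ∷ 0 ∷ rest) l ≡ (if not (elemℕ l (1 ∷ 0 ∷ rest)) then -1ℤ else 0ℤ)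
orientedFacetℕ-10 rest l inc
  rewrite elemℕ-below {1} rest (s≤s z<s) inc
        | elemℕ-below {0} rest z<s inc
        | IncreasingFrom⇒distinct rest inc
        | countSmallerℕ-below {1} rest (s≤s z≤n) inc
        | countSmallerℕ-below {0} rest z≤n inc
        | IncreasingFrom⇒no-inversions rest inc = refl

-- Composing with the transposition (0 1) negates every facet: for p ≥ 2 it
-- creates one inversion, for p ∈ {0,1} it exchanges facets 0 and 1 of
-- opposite signs.
swap01-omitting-sign : ∀ p q l → 1 ≤ p + q → l ≤ p + q →
  sgn p * orientedFacetℕ (map swap01 (omitting p q)) l ≡ (if swap01 l ≡ᵇ p then -1ℤ * sgn l else 0ℤ)
swap01-omitting-sign zero (suc q) l _ l≤
  rewrite map-swap01-increasing (segment 2 q) ≤-refl (segment-increasing 2 q ≤-refl)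
        | orientedFacetℕ-omitting 1 q l l≤
  with l
... | zero = refl
... | suc zero = refl
... | suc (suc _) = refl
swap01-omitting-sign (suc zero) q l _ l≤
  rewrite map-swap01-increasing (segment 2 q) ≤-refl (segment-increasing 2 q ≤-refl)
        | orientedFacetℕ-omitting 0 (suc q) l l≤
  with l
... | zero = refl
... | suc zero = refl
... | suc (suc _) = refl
swap01-omitting-sign (suc (suc p)) q l _ l≤
  rewrite map-swap01-increasing (omitting-tail p q) ≤-refl (omitting-tail-increasing p q)
        | orientedFacetℕ-10 (omitting-tail p q) l (omitting-tail-increasing p q)
  = swapped l (elemℕ-omitting (suc (suc p)) q l l≤)
  where
  swapped : ∀ l → elemℕ l (0 ∷ 1 ∷ omitting-tail p q) ≡ not (l ≡ᵇ suc (suc p)) →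
    sgn (suc (suc p)) * (if not (elemℕ l (1 ∷ 0 ∷ omitting-tail p q)) then -1ℤ else 0ℤ)
      ≡ (if swap01 l ≡ᵇ suc (suc p) then -1ℤ * sgn l else 0ℤ)
  swapped zero _ = ℤ.*-zeroʳ (sgn (suc (suc p)))
  swapped (suc zero) _ = ℤ.*-zeroʳ (sgn (suc (suc p)))
  swapped (suc (suc l)) l∈ rewrite l∈ | not-involutive (l ≡ᵇ p) =
    sgn-indicator (suc (suc p)) (suc (suc l)) -1ℤ

twist : Bool → ℕ → ℕ
twist false = id
twist true = swap01

twistSign : Bool → ℤ
twistSign false = 1ℤ
twistSign true = -1ℤ

twist-omitting-sign : ∀ s p q l → 1 ≤ p + q → l ≤ p + q →
  sgn p * orientedFacetℕ (map (twist s) (omitting p q)) l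
    ≡ (if twist s l ≡ᵇ p then twistSign s * sgn l else 0ℤ)
twist-omitting-sign false p q l _ l≤ rewrite map-id (omitting p q) = omitting-sign p q l l≤
twist-omitting-sign true = swap01-omitting-sign

twist-≡ᵇ : ∀ s x y → (twist s x ≡ᵇ twist s y) ≡ (x ≡ᵇ y)
twist-≡ᵇ false x y = refl
twist-≡ᵇ true zero zero = refl
twist-≡ᵇ true zero (suc zero) = refl
twist-≡ᵇ true zero (suc (suc y)) = refl
twist-≡ᵇ true (suc zero) zero = refl
twist-≡ᵇ true (suc zero) (suc zero) = refl
twist-≡ᵇ true (suc zero) (suc (suc y)) = refl
twist-≡ᵇ true (suc (suc x)) zero = refl
twist-≡ᵇ true (suc (suc x)) (suc zero) = refl
twist-≡ᵇ true (suc (suc x)) (suc (suc y)) = refl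

twist-injective : ∀ s {x y} → twist s x ≡ twist s y → x ≡ y
twist-injective s {x} {y} eq =
  ≡ᵇ-true⇒≡ (trans (sym (twist-≡ᵇ s x y)) (trans (cong (twist s x ≡ᵇ_) (sym eq)) (≡ᵇ-refl (twist s x))))

twist-< : ∀ s {x n} → 2 ≤ n → x < n → twist s x < n
twist-< false _ x<n = x<n
twist-< true {zero} 2≤n _ = 2≤n
twist-< true {suc zero} 2≤n _ = <-trans z<s 2≤n
twist-< true {suc (suc x)} _ x<n = x<n

distinctℕ-map : ∀ (f : ℕ → ℕ) → (∀ x y → (f x ≡ᵇ f y) ≡ (x ≡ᵇ y)) →
                ∀ ys → distinctℕ (map f ys) ≡ distinctℕ ys
distinctℕ-map f f-≡ᵇ [] = refl
distinctℕ-map f f-≡ᵇ (y ∷ ys) = cong₂ (λ a b → not a ∧ b) (elem-map ys) (distinctℕ-map f f-≡ᵇ ys)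
  where
  elem-map : ∀ zs → elemℕ (f y) (map f zs) ≡ elemℕ y zs
  elem-map [] = refl
  elem-map (z ∷ zs) = cong₂ _∨_ (f-≡ᵇ y z) (elem-map zs)

segment-tabulate : ∀ a n → tabulate {n = n} (λ j → a + toℕ j) ≡ segment a n
segment-tabulate a zero = refl
segment-tabulate a (suc n) =
  cong₂ _∷_ (+-identityʳ a) (trans (tabulate-cong (λ j → +-suc a (toℕ j))) (segment-tabulate (suc a) n))

map-suc-segment : ∀ a n → map suc (segment a n) ≡ segment (suc a) n
map-suc-segment a zero = refl
map-suc-segment a (suc n) = cong (suc a ∷_) (map-suc-segment (suc a) n)

map-+-segment : ∀ c a n → map (c +_) (segment a n) ≡ segment (c + a) n
map-+-segment c a zero = refl
map-+-segment c a (suc n) = cong (c + a ∷_) (trans (map-+-segment c (suc a) n) (cong (λ b → segment b n) (+-suc c a)))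

segment-++ : ∀ a n r → segment a n ++ segment (a + n) r ≡ segment a (n + r)
segment-++ a zero r = cong (λ b → segment b r) (+-identityʳ a)
segment-++ a (suc n) r =
  cong (a ∷_) (trans (cong (λ b → segment (suc a) n ++ segment b r) (+-suc a n)) (segment-++ (suc a) n r))

facet-toℕ : ∀ {n} (i : Fin (suc n)) → map toℕ (tabulate (punchIn i)) ≡ omitting (toℕ i) (n ∸ toℕ i)
facet-toℕ {n} Fin.zero = trans (map-tabulate (punchIn Fin.zero) toℕ) (segment-tabulate 1 n)
facet-toℕ {suc n} (Fin.suc i) = cong (0 ∷_) (begin
    map toℕ (tabulate (Fin.suc ∘ punchIn i))
  ≡⟨ map-tabulate (Fin.suc ∘ punchIn i) toℕ ⟩
    tabulate (suc ∘ toℕ ∘ punchIn i)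
  ≡⟨ sym (trans (cong (map suc) (map-tabulate (punchIn i) toℕ)) (map-tabulate (toℕ ∘ punchIn i) suc)) ⟩
    map suc (map toℕ (tabulate (punchIn i)))
  ≡⟨ cong (map suc) (facet-toℕ i) ⟩
    map suc (omitting (toℕ i) (n ∸ toℕ i))
  ≡⟨ map-++ suc (segment 0 (toℕ i)) _ ⟩
    map suc (segment 0 (toℕ i)) ++ map suc (segment (suc (toℕ i)) (n ∸ toℕ i))
  ≡⟨ cong₂ _++_ (map-suc-segment 0 (toℕ i)) (map-suc-segment (suc (toℕ i)) (n ∸ toℕ i)) ⟩
    segment 1 (toℕ i) ++ segment (suc (suc (toℕ i))) (n ∸ toℕ i)
  ∎)
  where open ≡-Reasoning

sumFin-cong : ∀ {n} {g h : Fin n → ℤ} → (∀ i → g i ≡ h i) → sumFin g ≡ sumFin h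
sumFin-cong {zero} _ = refl
sumFin-cong {suc n} g≡h = cong₂ ℤ._+_ (g≡h Fin.zero) (sumFin-cong (g≡h ∘ Fin.suc))

sumFin-zero : ∀ n → sumFin {n} (λ _ → 0ℤ) ≡ 0ℤ
sumFin-zero zero = refl
sumFin-zero (suc n) = trans (ℤ.+-identityˡ _) (sumFin-zero n)

sumFin-indicator : ∀ {n} I c → I < n → sumFin {n} (λ i → if I ≡ᵇ toℕ i then c else 0ℤ) ≡ c
sumFin-indicator {suc n} zero c _ = trans (cong (λ z → c ℤ.+ z) (sumFin-zero n)) (ℤ.+-identityʳ c)
sumFin-indicator {suc n} (suc I) c (s≤s I<n) = trans (ℤ.+-identityˡ _) (sumFin-indicator I c I<n)

sumFin-indicator₂ : ∀ {p q} I J c → I < p → J < q →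
  sumFin {p} (λ i → sumFin {q} (λ j → if (I ≡ᵇ toℕ i) ∧ (J ≡ᵇ toℕ j) then c else 0ℤ)) ≡ c
sumFin-indicator₂ {p} {q} I J c I<p J<q = trans (sumFin-cong {p} row) (sumFin-indicator {p} I c I<p)
  where
  row : ∀ i → sumFin {q} (λ j → if (I ≡ᵇ toℕ i) ∧ (J ≡ᵇ toℕ j) then c else 0ℤ)
            ≡ (if I ≡ᵇ toℕ i then c else 0ℤ)
  row i with I ≡ᵇ toℕ i
  ... | true = sumFin-indicator J c J<q
  ... | false = sumFin-zero q

∉-of-≢⊤ : ∀ {n} (σ : Subset n) → σ ≢ ⊤ → ∃ λ i → i ∉ σ
∉-of-≢⊤ {n} σ σ≢⊤ =
  Fin.¬∀⟶∃¬ n (_∈ σ) (_∈? σ) (λ all∈ → σ≢⊤ (⊆-antisym ⊆⊤ (λ {i} _ → all∈ i)))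

module Gluing (k m : ℕ) where

  glue : JVert k m → ℕ
  glue (inj₁ i) = toℕ i
  glue (inj₂ j) = suc k + toℕ j

  gluedFacet : ℕ → ℕ → List ℕ
  gluedFacet a b = omitting a (suc k ∸ a) ++ map (suc k +_) (omitting b (suc m ∸ b))

  map-glue-joinFacet : ∀ i j → map glue (joinFacet k m i j) ≡ gluedFacet (toℕ i) (toℕ j)
  map-glue-joinFacet i j = begin
      map glue (map inj₁ (facet k i) ++ map inj₂ (facet m j))
    ≡⟨ map-++ glue (map inj₁ (facet k i)) _ ⟩
      map glue (map inj₁ (facet k i)) ++ map glue (map inj₂ (facet m j))
    ≡⟨ cong₂ _++_ (sym (map-∘ (facet k i))) (sym (map-∘ (facet m j))) ⟩
      map toℕ (facet k i) ++ map ((suc k +_) ∘ toℕ) (facet m j)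
    ≡⟨ cong₂ _++_ (facet-toℕ i) (trans (map-∘ (facet m j)) (cong (map (suc k +_)) (facet-toℕ j))) ⟩
      gluedFacet (toℕ i) (toℕ j)
    ∎
    where open ≡-Reasoning

  gluedFacet-last : ∀ b → b ≤ suc m → gluedFacet (suc k) b ≡ omitting (suc k + b) (suc m ∸ b)
  gluedFacet-last b b≤ = begin
      (segment 0 (suc k) ++ segment (suc (suc k)) (k ∸ k)) ++ map (suc k +_) (omitting b (suc m ∸ b))
    ≡⟨ cong₂ _++_ (trans (cong (λ n → segment 0 (suc k) ++ segment (suc (suc k)) n) (n∸n≡0 k)) (++-identityʳ _))
                  (map-++ (suc k +_) (segment 0 b) _) ⟩
      segment 0 (suc k) ++ (map (suc k +_) (segment 0 b) ++ map (suc k +_) (segment (suc b) (suc m ∸ b)))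
    ≡⟨ cong (segment 0 (suc k) ++_)
            (cong₂ _++_ (trans (map-+-segment (suc k) 0 b) (cong (λ a → segment a b) (+-identityʳ (suc k))))
                        (map-+-segment (suc k) (suc b) _)) ⟩
      segment 0 (suc k) ++ (segment (suc k) b ++ segment (suc k + suc b) (suc m ∸ b))
    ≡⟨ sym (++-assoc (segment 0 (suc k)) _ _) ⟩
      (segment 0 (suc k) ++ segment (suc k) b) ++ segment (suc k + suc b) (suc m ∸ b)
    ≡⟨ cong₂ _++_ (segment-++ 0 (suc k) b) (cong (λ a → segment a (suc m ∸ b)) (+-suc (suc k) b)) ⟩
      omitting (suc k + b) (suc m ∸ b)
    ∎
    where open ≡-Reasoning

  gluedFacet-first : ∀ a → a ≤ suc k → gluedFacet a 0 ≡ omitting a ((suc k ∸ a) + suc m)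
  gluedFacet-first a a≤ = begin
      (segment 0 a ++ segment (suc a) (suc k ∸ a)) ++ map (suc k +_) (segment 1 (suc m))
    ≡⟨ ++-assoc (segment 0 a) _ _ ⟩
      segment 0 a ++ (segment (suc a) (suc k ∸ a) ++ map (suc k +_) (segment 1 (suc m)))
    ≡⟨ cong (λ xs → segment 0 a ++ (segment (suc a) (suc k ∸ a) ++ xs))
            (trans (map-+-segment (suc k) 1 (suc m)) (cong (λ c → segment c (suc m)) (sym end-of-first))) ⟩
      segment 0 a ++ (segment (suc a) (suc k ∸ a) ++ segment (suc a + (suc k ∸ a)) (suc m))
    ≡⟨ cong (segment 0 a ++_) (segment-++ (suc a) (suc k ∸ a) (suc m)) ⟩
      omitting a ((suc k ∸ a) + suc m)
    ∎
    where
    open ≡-Reasoning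
    end-of-first : suc a + (suc k ∸ a) ≡ suc k + 1
    end-of-first = trans (cong suc (m+[n∸m]≡n a≤)) (+-comm 1 (suc k))

  -- for a ≤ k both halves contain the glued vertex k+1
  gluedFacet-repeats : ∀ a b → a ≤ k → distinctℕ (gluedFacet a (suc b)) ≡ false
  gluedFacet-repeats a b a≤k = distinctℕ-repeat (omitting a (suc k ∸ a)) (suc k + 0) _ k+1∈
    where
    k+1∈ : elemℕ (suc k + 0) (omitting a (suc k ∸ a)) ≡ true
    k+1∈ rewrite +-identityʳ k
               | elemℕ-++ (suc k) (segment 0 a) (segment (suc a) (suc k ∸ a))
               | elemℕ-segment-inside (suc k) (suc a) (suc k ∸ a) (s≤s a≤k)
                   (subst (suc k <_) (sym (cong suc (m+[n∸m]≡n (m≤n⇒m≤1+n a≤k)))) ≤-refl)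
      = ∨-zeroʳ _

  module _ (s : Bool) where

    term : ℕ → ℕ → ℕ → ℤ
    term a b l = sgn (a + b) * orientedFacetℕ (map (twist s) (gluedFacet a b)) l

    term-last : ∀ b l → b ≤ suc m → l ≤ suc k + suc m →
      term (suc k) b l ≡ (if twist s l ≡ᵇ suc k + b then twistSign s * sgn l else 0ℤ)
    term-last b l b≤ l≤ =
      trans (cong (λ xs → sgn (suc k + b) * orientedFacetℕ (map (twist s) xs) l) (gluedFacet-last b b≤)) $
      twist-omitting-sign s (suc k + b) (suc m ∸ b) l z<s (subst (l ≤_) (sym size) l≤)
      where
      size : suc k + b + (suc m ∸ b) ≡ suc k + suc m
      size = trans (+-assoc (suc k) b _) (cong (suc k +_) (m+[n∸m]≡n b≤))

    term-first : ∀ a l → a ≤ suc k → l ≤ suc k + suc m →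
      term a 0 l ≡ (if twist s l ≡ᵇ a then twistSign s * sgn l else 0ℤ)
    term-first a l a≤ l≤ =
      trans (cong₂ (λ c xs → sgn c * orientedFacetℕ (map (twist s) xs) l) (+-identityʳ a) (gluedFacet-first a a≤)) $
      twist-omitting-sign s a ((suc k ∸ a) + suc m) l (subst (1 ≤_) (sym size) z<s) (subst (l ≤_) (sym size) l≤)
      where
      size : a + ((suc k ∸ a) + suc m) ≡ suc k + suc m
      size = trans (sym (+-assoc a _ _)) (cong (_+ suc m) (m+[n∸m]≡n a≤))

    term-repeats : ∀ a b l → a ≤ k → term a (suc b) l ≡ 0ℤ
    term-repeats a b l a≤k
      rewrite distinctℕ-map (twist s) (twist-≡ᵇ s) (gluedFacet a (suc b)) | gluedFacet-repeats a b a≤k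
      = ℤ.*-zeroʳ (sgn (a + suc b))

    term-low : ∀ a b l → a ≤ suc k → b ≤ suc m → l ≤ suc k + suc m → twist s l ≤ k →
      term a b l ≡ (if (twist s l ≡ᵇ a) ∧ (0 ≡ᵇ b) then twistSign s * sgn l else 0ℤ)
    term-low a b l a≤ b≤ l≤ t≤k with m≤n⇒m<n∨m≡n a≤
    ... | inj₂ refl
      rewrite term-last b l b≤ l≤
            | ≢⇒≡ᵇ-false (<⇒≢ (≤-<-trans t≤k (m≤m+n (suc k) b)))
            | ≢⇒≡ᵇ-false (<⇒≢ (s≤s t≤k)) = refl
    term-low a zero l a≤ b≤ l≤ t≤k | inj₁ _
      rewrite term-first a l a≤ l≤ | ∧-identityʳ (twist s l ≡ᵇ a) = refl
    term-low a (suc b) l a≤ b≤ l≤ t≤k | inj₁ (s≤s a≤k)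
      rewrite term-repeats a b l a≤k | ∧-zeroʳ (twist s l ≡ᵇ a) = refl

    term-high : ∀ a b j l → a ≤ suc k → b ≤ suc m → l ≤ suc k + suc m → twist s l ≡ suc k + j →
      term a b l ≡ (if (suc k ≡ᵇ a) ∧ (j ≡ᵇ b) then twistSign s * sgn l else 0ℤ)
    term-high a b j l a≤ b≤ l≤ t≡ with m≤n⇒m<n∨m≡n a≤
    ... | inj₂ refl rewrite term-last b l b≤ l≤ | t≡ | +-cancelˡ-≡ᵇ (suc k) j b | ≡ᵇ-refl k = refl
    term-high a zero j l a≤ b≤ l≤ t≡ | inj₁ (s≤s a≤k)
      rewrite term-first a l a≤ l≤ | t≡
            | ≢⇒≡ᵇ-false (≢-sym (<⇒≢ (≤-trans (s≤s a≤k) (m≤m+n (suc k) j))))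
            | ≢⇒≡ᵇ-false (≢-sym (<⇒≢ (s≤s a≤k))) = refl
    term-high a (suc b) j l a≤ b≤ l≤ t≡ | inj₁ (s≤s a≤k)
      rewrite term-repeats a b l a≤k | ≢⇒≡ᵇ-false (≢-sym (<⇒≢ (s≤s a≤k))) = refl

    vertexCount : suc (suc k + suc m) ≡ suc (suc (k + m + 1))
    vertexCount = cong (suc ∘ suc) (trans (+-suc k m) (+-comm 1 (k + m)))

    glue-< : ∀ x → glue x < suc (suc k + suc m)
    glue-< (inj₁ i) = <-≤-trans (Fin.toℕ<n i) (s≤s (s≤s (m≤m+n k (suc m))))
    glue-< (inj₂ j) = subst (suc k + toℕ j <_) (+-suc (suc k) (suc m)) (+-monoʳ-< (suc k) (Fin.toℕ<n j))

    vertexMap : JVert k m → SVert (k + m + 1)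
    vertexMap x = fromℕ< (subst (twist s (glue x) <_) vertexCount (twist-< s (s≤s (s≤s z≤n)) (glue-< x)))

    toℕ-vertexMap : ∀ x → toℕ (vertexMap x) ≡ twist s (glue x)
    toℕ-vertexMap x = Fin.toℕ-fromℕ< _

    vertexMap-glue : ∀ x y → vertexMap x ≡ vertexMap y → glue x ≡ glue y
    vertexMap-glue x y eq =
      twist-injective s (trans (sym (toℕ-vertexMap x)) (trans (cong toℕ eq) (toℕ-vertexMap y)))

    pushFund-summand : ∀ i j (l : SVert (k + m + 1)) →
      sgn (toℕ i + toℕ j) * orientedFacet (k + m + 1) (map vertexMap (joinFacet k m i j)) l
        ≡ term (toℕ i) (toℕ j) (toℕ l)
    pushFund-summand i j l = cong (sgn (toℕ i + toℕ j) *_) (begin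
        orientedFacet (k + m + 1) (map vertexMap (joinFacet k m i j)) l
      ≡⟨ orientedFacet-toℕ (k + m + 1) (map vertexMap (joinFacet k m i j)) l ⟩
        orientedFacetℕ (map toℕ (map vertexMap (joinFacet k m i j))) (toℕ l)
      ≡⟨ cong (λ xs → orientedFacetℕ xs (toℕ l)) (begin
            map toℕ (map vertexMap (joinFacet k m i j))
          ≡⟨ sym (map-∘ (joinFacet k m i j)) ⟩
            map (toℕ ∘ vertexMap) (joinFacet k m i j)
          ≡⟨ map-cong toℕ-vertexMap (joinFacet k m i j) ⟩
            map (twist s ∘ glue) (joinFacet k m i j)
          ≡⟨ map-∘ (joinFacet k m i j) ⟩
            map (twist s) (map glue (joinFacet k m i j))
          ≡⟨ cong (map (twist s)) (map-glue-joinFacet i j) ⟩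
            map (twist s) (gluedFacet (toℕ i) (toℕ j))
          ∎) ⟩
        orientedFacetℕ (map (twist s) (gluedFacet (toℕ i) (toℕ j))) (toℕ l)
      ∎)
      where open ≡-Reasoning

    toℕ-≤ : ∀ (l : SVert (k + m + 1)) → toℕ l ≤ suc k + suc m
    toℕ-≤ l = ≤-pred (subst (toℕ l <_) (sym vertexCount) (Fin.toℕ<n l))

    -- Exactly one summand survives: the facet (t , 0) if t ≤ k and the
    -- facet (k+1 , t−k−1) otherwise, where t = twist s l.
    pushFund-vertexMap : ∀ l → pushFund k m vertexMap l ≡ twistSign s * sgn (toℕ l)
    pushFund-vertexMap l with twist s (toℕ l) ≤? k
    ... | yes t≤k =
      trans (sumFin-cong {suc (suc k)} λ i → sumFin-cong {suc (suc m)} λ j →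
               trans (pushFund-summand i j l)
                     (term-low (toℕ i) (toℕ j) (toℕ l) (Fin.toℕ≤pred[n] i) (Fin.toℕ≤pred[n] j) (toℕ-≤ l) t≤k))
            (sumFin-indicator₂ {suc (suc k)} {suc (suc m)} (twist s (toℕ l)) 0 _ (s≤s (m≤n⇒m≤1+n t≤k)) z<s)
    ... | no t≰k =
      trans (sumFin-cong {suc (suc k)} λ i → sumFin-cong {suc (suc m)} λ j →
               trans (pushFund-summand i j l)
                     (term-high (toℕ i) (toℕ j) t-k-1 (toℕ l)
                                (Fin.toℕ≤pred[n] i) (Fin.toℕ≤pred[n] j) (toℕ-≤ l) t≡))
            (sumFin-indicator₂ {suc (suc k)} {suc (suc m)} (suc k) t-k-1 _ ≤-refl (s≤s t-k-1≤))
      where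
      t-k-1 : ℕ
      t-k-1 = twist s (toℕ l) ∸ suc k
      t≡ : twist s (toℕ l) ≡ suc k + t-k-1
      t≡ = sym (m+[n∸m]≡n (≰⇒> t≰k))
      t-k-1≤ : t-k-1 ≤ suc m
      t-k-1≤ = subst (t-k-1 ≤_) (m+n∸m≡n (suc k) (suc m))
                 (∸-monoˡ-≤ (suc k) (≤-pred (twist-< s (s≤s (s≤s z≤n)) (s≤s (toℕ-≤ l)))))

    vertexMap-simplicial : IsSimplicial k m vertexMap
    vertexMap-simplicial A B A≢⊤ B≢⊤ with ∉-of-≢⊤ A A≢⊤
    ... | i , i∉A with m≤n⇒m<n∨m≡n (Fin.toℕ≤pred[n] i)
    ...   | inj₁ (s≤s i≤k) = vertexMap (inj₁ i) , misses-A , misses-B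
      where
      misses-A : ∀ i′ → i′ ∈ A → vertexMap (inj₁ i′) ≢ vertexMap (inj₁ i)
      misses-A i′ i′∈A eq =
        i∉A (subst (_∈ A) (Fin.toℕ-injective (vertexMap-glue (inj₁ i′) (inj₁ i) eq)) i′∈A)
      misses-B : ∀ j → j ∈ B → vertexMap (inj₂ j) ≢ vertexMap (inj₁ i)
      misses-B j _ eq =
        <⇒≱ (s≤s i≤k) (subst (suc k ≤_) (vertexMap-glue (inj₂ j) (inj₁ i) eq) (m≤m+n (suc k) (toℕ j)))
    ...   | inj₂ i≡k+1 with ∉-of-≢⊤ B B≢⊤
    ...     | j , j∉B = vertexMap (inj₂ j) , misses-A , misses-B
      where
      misses-A : ∀ i′ → i′ ∈ A → vertexMap (inj₁ i′) ≢ vertexMap (inj₂ j)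
      misses-A i′ i′∈A eq = i∉A (subst (_∈ A) (Fin.toℕ-injective (trans i′≡k+1 (sym i≡k+1))) i′∈A)
        where
        i′≡k+1 : toℕ i′ ≡ suc k
        i′≡k+1 = ≤-antisym (Fin.toℕ≤pred[n] i′)
                   (subst (suc k ≤_) (sym (vertexMap-glue (inj₁ i′) (inj₂ j) eq)) (m≤m+n (suc k) (toℕ j)))
      misses-B : ∀ j′ → j′ ∈ B → vertexMap (inj₂ j′) ≢ vertexMap (inj₂ j)
      misses-B j′ j′∈B eq =
        j∉B (subst (_∈ B) (Fin.toℕ-injective (+-cancelˡ-≡ (suc k) _ _ (vertexMap-glue (inj₂ j′) (inj₂ j) eq)))
                   j′∈B)

relativeOrientation : Orientation → Orientation → Bool
relativeOrientation pos pos = false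
relativeOrientation neg neg = false
relativeOrientation pos neg = true
relativeOrientation neg pos = true

relativeOrientation-sign : ∀ o₁ o₂ → oℤ o₁ * twistSign (relativeOrientation o₁ o₂) ≡ oℤ o₂
relativeOrientation-sign pos pos = refl
relativeOrientation-sign pos neg = refl
relativeOrientation-sign neg neg = refl
relativeOrientation-sign neg pos = refl

proposition2 : (k m : ℕ) (o₁ o₂ : Orientation) →
    ∃ λ (f : JVert k m → SVert (k + m + 1)) →
      IsSimplicial k m f × HasDegree k m o₁ o₂ f 1ℤ
proposition2 k m o₁ o₂ = vertexMap s , vertexMap-simplicial s , degree-one
  where
  open Gluing k m
  s = relativeOrientation o₁ o₂
  degree-one : HasDegree k m o₁ o₂ (vertexMap s) 1ℤ
  degree-one l = begin
      oℤ o₁ * pushFund k m (vertexMap s) l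
    ≡⟨ cong (oℤ o₁ *_) (pushFund-vertexMap s l) ⟩
      oℤ o₁ * (twistSign s * sgn (toℕ l))
    ≡⟨ sym (ℤ.*-assoc (oℤ o₁) (twistSign s) (sgn (toℕ l))) ⟩
      oℤ o₁ * twistSign s * sgn (toℕ l)
    ≡⟨ cong (_* sgn (toℕ l)) (relativeOrientation-sign o₁ o₂) ⟩
      oℤ o₂ * sgn (toℕ l)
    ≡⟨ sym (ℤ.*-identityˡ _) ⟩
      1ℤ * (oℤ o₂ * sgn (toℕ l))
    ∎
    where open ≡-Reasoning
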